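{- Let $n\geq 4$ and $k$ be even integers with $0<k\leq n/2$. Then the accordion graph $A[n,k]$ is circulant if and only if $k=2$.
   Context: The accordion graph $A[n,k]$ ($n\geq 3$, $0<k\leq n/2$) has vertex set $\{u_1,\dots,u_n,v_1,\dots,v_n\}$ and edge set $\{u_iu_{i+1}, v_iv_{i+1}, u_iv_i, u_iv_{i+k} : i\in\{1,\dots,n\}\}$, indices modulo $n$. For a positive integer $m$ and a set $S$ of positive integers less than $m$, the circulant graph $\mathrm{Ci}[m,S]$ has vertices $x_1,\dots,x_m$, with $x_i$ adjacent to $x_{i\pm s}$ for every $s\in S$ (indices modulo $m$). A graph is circulant if it is isomorphic to some circulant graph $\mathrm{Ci}[m,S]$. -}

module Defs where

open import Level using (0ℓ)
open import Data.Nat using (ℕ; suc; _+_; _<_; _%_; NonZero)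
open import Data.Fin using (Fin; toℕ)
open import Data.Sum using (_⊎_; inj₁; inj₂)
open import Data.Product using (Σ; ∃; ∃-syntax; _×_; _,_)
open import Relation.Binary.PropositionalEquality using (_≡_)
open import Function.Bundles using (_⤖_; Bijection; _⇔_)

record Graph : Set₁ where
  field
    Vertex : Set
    Adj    : Vertex → Vertex → Set
open Graph public

_≅_ : Graph → Graph → Set
G ≅ H = Σ (Vertex G ⤖ Vertex H) λ f →
          ∀ x y → Adj G x y ⇔ Adj H (Bijection.to f x) (Bijection.to f y)

-- Indices are 0-based: u_i = inj₁ i, v_i = inj₂ i, i ∈ {0,…,n-1}, all mod n.
-- Directed generating edges of A[n,k]: u_i u_{i+1}, v_i v_{i+1}, u_i v_i, u_i v_{i+k}.
data AccEdge (n k : ℕ) .{{_ : NonZero n}} : Fin n ⊎ Fin n → Fin n ⊎ Fin n → Set where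
  uu : ∀ i j → toℕ j ≡ (toℕ i + 1) % n → AccEdge n k (inj₁ i) (inj₁ j)
  vv : ∀ i j → toℕ j ≡ (toℕ i + 1) % n → AccEdge n k (inj₂ i) (inj₂ j)
  uv : ∀ i → AccEdge n k (inj₁ i) (inj₂ i)
  uvk : ∀ i j → toℕ j ≡ (toℕ i + k) % n → AccEdge n k (inj₁ i) (inj₂ j)

Accordion : (n k : ℕ) .{{_ : NonZero n}} → Graph
Accordion n k = record
  { Vertex = Fin n ⊎ Fin n
  ; Adj    = λ x y → AccEdge n k x y ⊎ AccEdge n k y x }

Circ : (m : ℕ) .{{_ : NonZero m}} → (S : ℕ → Set) → Graph
Circ m S = record
  { Vertex = Fin m
  ; Adj    = λ x y → ∃[ s ] (S s × (toℕ y ≡ (toℕ x + s) % m ⊎ toℕ x ≡ (toℕ y + s) % m)) }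

IsCirculant : Graph → Set₁
IsCirculant G = ∃[ m ] Σ (NonZero m) λ nz → Σ (ℕ → Set) λ S →
  (∀ s → S s → 0 < s × s < m) × (G ≅ Circ m {{nz}} S)

module Submission where

-- Suppose A[n,k] ≅ Ci[m,S] via a labelling ℓ; then m = 2n. Every reflection x ↦ r − x of ℤ/2n
-- is an automorphism of Ci[2n,S], and the one through ℓa + ℓb swaps a and b, so if x is the only
-- common neighbour of a and b then ℓa + ℓb ≡ 2ℓx (mod 2n). For k ≥ 4, u_{j+1} is the only common
-- neighbour of u_j and u_{j+2}, and likewise for v, so ℓ(u_j) and ℓ(v_j) are arithmetic
-- progressions mod 2n of period n, hence of even step and constant parity. The reflection of v₀
-- through u₀ is a neighbour of u₀, and for even k this forces the two parities to agree, so ℓ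
-- misses a whole parity class.
-- For k = 2, u₀ … u_{n−1} v₁ … v_{n−1} v₀ is a Hamiltonian cycle and every remaining edge joins
-- vertices n − 1 apart along it, so A[n,2] ≅ Ci[2n, {1, n−1}].

open import Level using (0ℓ)
open import Data.Nat.Base as ℕ using (ℕ; zero; suc; NonZero; z≤n; s≤s)
import Data.Nat.Properties as ℕ
import Data.Nat.Divisibility as ℕ
import Data.Nat.DivMod as ℕ
open import Data.Integer.Base using (ℤ; +_; 0ℤ; 1ℤ; -1ℤ; _+_; _-_; _*_; -_; _%ℕ_; _/ℕ_)
import Data.Integer.Properties as ℤ
open import Data.Integer.DivMod using (n%ℕd<d; a≡a%ℕn+[a/ℕn]*n)
open import Data.Integer.Divisibility.Signed
  using (_∣_; divides; quotient; ∣-trans; ∣ᵤ⇒∣; ∣⇒∣ᵤ; ∣m⇒∣-m; ∣m∣n⇒∣m+n; ∣n⇒∣m*n; *-cancelˡ-∣)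
open import Data.Integer.Tactic.RingSolver using (solve; solve-∀)
open import Data.Fin.Base using (Fin; toℕ; fromℕ<; _↑ʳ_)
open import Data.Fin.Properties using (toℕ-fromℕ<; toℕ-injective; toℕ<n; +↔⊎; toℕ-↑ˡ; toℕ-↑ʳ)
open import Data.Fin.Permutation using (↔⇒≡)
open import Data.List.Base using ([]; _∷_)
open import Data.Product.Base using (∃; _,_; proj₁; proj₂; _×_)
open import Data.Sum.Base using (_⊎_; inj₁; inj₂; swap)
open import Data.Sum.Function.Propositional using (_⊎-↔_)
open import Data.Empty using (⊥; ⊥-elim)
open import Function.Base using (_∘_)
open import Function.Bundles using (_⇔_; mk⇔; _↔_; mk↔ₛ′; _⤖_; Bijection; Equivalence)
import Function.Properties.Equivalence as ⇔
open import Function.Properties.Inverse using (↔-refl; ↔-sym; ↔-trans; ↔⇒⤖)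
open import Function.Properties.Bijection using (⤖⇒↔)
open import Relation.Binary.Bundles using (Setoid)
open import Relation.Binary.PropositionalEquality
open import Relation.Nullary.Negation using (¬_; contradiction)
open import Relation.Nullary.Decidable using (decidable-stable)
import Relation.Binary.Reasoning.Setoid as SetoidReasoning

open import Defs

infix 4 _≡_mod_

-- A record rather than a synonym for + m ∣ a - b, so that a and b stay inferable.
record _≡_mod_ (a b : ℤ) (m : ℕ) : Set where
  constructor mk≡mod
  field m∣a-b : + m ∣ a - b
open _≡_mod_ public

module _ {m : ℕ} where

  ≡mod-refl : ∀ {a} → a ≡ a mod m
  ≡mod-refl {a} = mk≡mod (divides 0ℤ (ℤ.+-inverseʳ a))

  ≡⇒≡mod : ∀ {a b} → a ≡ b → a ≡ b mod m
  ≡⇒≡mod refl = ≡mod-refl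

  ≡mod-sym : ∀ {a b} → a ≡ b mod m → b ≡ a mod m
  ≡mod-sym {a} {b} (mk≡mod p) = mk≡mod (subst (+ m ∣_) (flip a b) (∣m⇒∣-m p))
    where flip : ∀ a b → - (a - b) ≡ b - a
          flip = solve-∀

  ≡mod-trans : ∀ {a b c} → a ≡ b mod m → b ≡ c mod m → a ≡ c mod m
  ≡mod-trans {a} {b} {c} (mk≡mod p) (mk≡mod q) =
    mk≡mod (subst (+ m ∣_) (telescope a b c) (∣m∣n⇒∣m+n p q))
    where telescope : ∀ a b c → (a - b) + (b - c) ≡ a - c
          telescope = solve-∀

  +-cong-mod : ∀ {a b c d} → a ≡ b mod m → c ≡ d mod m → a + c ≡ b + d mod m
  +-cong-mod {a} {b} {c} {d} (mk≡mod p) (mk≡mod q) =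
    mk≡mod (subst (+ m ∣_) (regroup a b c d) (∣m∣n⇒∣m+n p q))
    where regroup : ∀ a b c d → (a - b) + (c - d) ≡ (a + c) - (b + d)
          regroup = solve-∀

  +-congˡ-mod : ∀ c {a b} → a ≡ b mod m → c + a ≡ c + b mod m
  +-congˡ-mod c = +-cong-mod (≡mod-refl {a = c})

  +-congʳ-mod : ∀ c {a b} → a ≡ b mod m → a + c ≡ b + c mod m
  +-congʳ-mod c p = +-cong-mod p (≡mod-refl {a = c})

  neg-cong-mod : ∀ {a b} → a ≡ b mod m → - a ≡ - b mod m
  neg-cong-mod {a} {b} (mk≡mod p) = mk≡mod (subst (+ m ∣_) (negate a b) (∣m⇒∣-m p))
    where negate : ∀ a b → - (a - b) ≡ - a - - b
          negate = solve-∀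

  modulus≡0 : + m ≡ 0ℤ mod m
  modulus≡0 = mk≡mod (divides 1ℤ (trans (ℤ.+-identityʳ (+ m)) (sym (ℤ.*-identityˡ (+ m)))))

  ∣⇒≡0-mod : ∀ {a} → + m ∣ a → a ≡ 0ℤ mod m
  ∣⇒≡0-mod {a} p = mk≡mod (subst (+ m ∣_) (sym (ℤ.+-identityʳ a)) p)

  ≡0-mod⇒∣ : ∀ {a} → a ≡ 0ℤ mod m → + m ∣ a
  ≡0-mod⇒∣ {a} (mk≡mod p) = subst (+ m ∣_) (ℤ.+-identityʳ a) p

  ≡mod-by-difference : ∀ {a b a′ b′} → a - b ≡ a′ - b′ → a ≡ b mod m → a′ ≡ b′ mod m
  ≡mod-by-difference eq (mk≡mod p) = mk≡mod (subst (+ m ∣_) eq p)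

  ≡+⇔-≡ : ∀ {a b c} → (b ≡ a + c mod m) ⇔ (b - a ≡ c mod m)
  ≡+⇔-≡ {a} {b} {c} = mk⇔ (≡mod-by-difference (regroup a b c)) (≡mod-by-difference (sym (regroup a b c)))
    where regroup : ∀ a b c → b - (a + c) ≡ b - a - c
          regroup = solve-∀

  ≡mod-weaken : ∀ {d a b} → d ℕ.∣ m → a ≡ b mod m → a ≡ b mod d
  ≡mod-weaken d∣m (mk≡mod p) = mk≡mod (∣-trans (∣ᵤ⇒∣ d∣m) p)

≡mod-setoid : ℕ → Setoid 0ℓ 0ℓ
≡mod-setoid m = record
  { Carrier       = ℤ
  ; _≈_           = λ a b → a ≡ b mod m
  ; isEquivalence = record { refl = ≡mod-refl ; sym = ≡mod-sym ; trans = ≡mod-trans }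
  }

module ≡mod-Reasoning (m : ℕ) = SetoidReasoning (≡mod-setoid m)

*-cancelˡ-mod : ∀ q {m a b} .{{_ : NonZero q}} → + q * a ≡ + q * b mod q ℕ.* m → a ≡ b mod m
*-cancelˡ-mod q {m} {a} {b} (mk≡mod p) =
  mk≡mod (*-cancelˡ-∣ (+ q) (subst₂ _∣_ (ℤ.pos-* q m) (factor (+ q) a b) p))
  where factor : ∀ q a b → q * a - q * b ≡ q * (a - b)
        factor = solve-∀

nonzero-shift-≢mod : ∀ {m d} a → 0 ℕ.< d → d ℕ.< m → ¬ (+ d + a ≡ a mod m)
nonzero-shift-≢mod {m} {d} a 0<d d<m (mk≡mod p) =
  ℕ.>⇒∤ {{ℕ.>-nonZero 0<d}} d<m (∣⇒∣ᵤ (subst (+ m ∣_) (cancel (+ d) a) p))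
  where cancel : ∀ d a → d + a - a ≡ d
        cancel = solve-∀

module _ {m : ℕ} where

  private
    ordered-≡mod⇒≡ : ∀ {x y} → y ℕ.≤ x → x ℕ.< m → + x ≡ + y mod m → x ≡ y
    ordered-≡mod⇒≡ {x} {y} y≤x x<m (mk≡mod p) =
      ℕ.≤-antisym (ℕ.m∸n≡0⇒m≤n (small-multiple≡0 m∣x∸y (ℕ.≤-<-trans (ℕ.m∸n≤m x y) x<m))) y≤x
      where
      m∣x∸y : m ℕ.∣ x ℕ.∸ y
      m∣x∸y = ∣⇒∣ᵤ (subst (+ m ∣_) (trans (ℤ.m-n≡m⊖n x y) (ℤ.⊖-≥ y≤x)) p)
      small-multiple≡0 : ∀ {d} → m ℕ.∣ d → d ℕ.< m → d ≡ 0
      small-multiple≡0 {zero}  _   _   = refl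
      small-multiple≡0 {suc _} m∣d d<m = contradiction m∣d (ℕ.>⇒∤ d<m)

  ≡mod⇒≡ : ∀ {x y} → x ℕ.< m → y ℕ.< m → + x ≡ + y mod m → x ≡ y
  ≡mod⇒≡ {x} {y} x<m y<m p with ℕ.≤-total y x
  ... | inj₁ y≤x = ordered-≡mod⇒≡ y≤x x<m p
  ... | inj₂ x≤y = sym (ordered-≡mod⇒≡ x≤y y<m (≡mod-sym p))

ι : ∀ {m} → Fin m → ℤ
ι i = + toℕ i

residue : ∀ {m} .{{_ : NonZero m}} → ℤ → Fin m
residue {m} z = fromℕ< (n%ℕd<d z m)

module _ {m : ℕ} .{{_ : NonZero m}} where

  %ℕ-≡mod : ∀ z → + (z %ℕ m) ≡ z mod m
  %ℕ-≡mod z = ≡mod-sym (mk≡mod (divides (z /ℕ m) (begin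
      z - r                 ≡⟨ cong (_- r) (a≡a%ℕn+[a/ℕn]*n z m) ⟩
      r + q * + m - r       ≡⟨ cancel r (q * + m) ⟩
      q * + m               ∎)))
    where open ≡-Reasoning
          r q : ℤ
          r = + (z %ℕ m)
          q = z /ℕ m
          cancel : ∀ r x → r + x - r ≡ x
          cancel = solve-∀

  ι-residue : ∀ z → ι (residue {m} z) ≡ z mod m
  ι-residue z = subst (λ x → + x ≡ z mod m) (sym (toℕ-fromℕ< _)) (%ℕ-≡mod z)

  ι-injective : ∀ {i j : Fin m} → ι i ≡ ι j mod m → i ≡ j
  ι-injective p = toℕ-injective (≡mod⇒≡ (toℕ<n _) (toℕ<n _) p)

  ≡residue : ∀ {i : Fin m} {z} → ι i ≡ z mod m → i ≡ residue z
  ≡residue {z = z} p = ι-injective (≡mod-trans p (≡mod-sym (ι-residue z)))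

  residue-cong : ∀ {a b} → a ≡ b mod m → residue {m} a ≡ residue b
  residue-cong {a} p = ≡residue (≡mod-trans (ι-residue a) p)

  residue-ι : ∀ (i : Fin m) → residue (ι i) ≡ i
  residue-ι i = sym (≡residue ≡mod-refl)

  %-step⇔ : ∀ (i j : Fin m) s → (toℕ j ≡ (toℕ i ℕ.+ s) ℕ.% m) ⇔ (ι j ≡ ι i + + s mod m)
  %-step⇔ i j s = mk⇔
    (λ e → subst (λ x → + x ≡ ι i + + s mod m) (sym e) (%ℕ-≡mod (ι i + + s)))
    (λ p → ≡mod⇒≡ (toℕ<n j) (ℕ.m%n<n _ m) (≡mod-trans p (≡mod-sym (%ℕ-≡mod (ι i + + s)))))

reflect-step : ∀ {m} r {a b a′ b′ c} →
               b ≡ a + c mod m → a′ ≡ r - a mod m → b′ ≡ r - b mod m → a′ ≡ b′ + c mod m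
reflect-step {m} r {a} {b} {a′} {b′} {c} b≡a+c a′≡r-a b′≡r-b = begin
  a′                ≈⟨ a′≡r-a ⟩
  r - a             ≡⟨ solve (r ∷ a ∷ b ∷ []) ⟩
  (r - b) + (b - a) ≈⟨ +-cong-mod (≡mod-sym b′≡r-b) (+-congʳ-mod (- a) b≡a+c) ⟩
  b′ + (a + c - a)  ≡⟨ solve (b′ ∷ a ∷ c ∷ []) ⟩
  b′ + c            ∎
  where open ≡mod-Reasoning m

reflection≡centre⇒≡ : ∀ {m c d w} → w ≡ c + c - d mod m → w ≡ c mod m → d ≡ c mod m
reflection≡centre⇒≡ {m} {c} {d} {w} w≡c+c-d w≡c = begin
  d                 ≡⟨ solve (c ∷ d ∷ []) ⟩
  c + c - (c + c - d) ≈⟨ +-congˡ-mod (c + c) (neg-cong-mod (≡mod-trans (≡mod-sym w≡c+c-d) w≡c)) ⟩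
  c + c - c         ≡⟨ solve (c ∷ []) ⟩
  c                 ∎
  where open ≡mod-Reasoning m

reflection≡point⇒≡ : ∀ {m c d w} → w ≡ c + c - d mod 2 ℕ.* m → w ≡ d mod 2 ℕ.* m → c ≡ d mod m
reflection≡point⇒≡ {m} {c} {d} {w} w≡c+c-d w≡d = *-cancelˡ-mod 2 (begin
  + 2 * c           ≡⟨ solve (c ∷ d ∷ []) ⟩
  (c + c - d) + d   ≈⟨ +-congʳ-mod d (≡mod-trans (≡mod-sym w≡c+c-d) w≡d) ⟩
  d + d             ≡⟨ solve (d ∷ []) ⟩
  + 2 * d           ∎)
  where open ≡mod-Reasoning (2 ℕ.* m)

module _ {m : ℕ} .{{_ : NonZero m}} {S : ℕ → Set} where

  circ-reflect : ∀ r {x y x′ y′ : Fin m} → Adj (Circ m S) x y →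
                 ι x′ ≡ r - ι x mod m → ι y′ ≡ r - ι y mod m → Adj (Circ m S) x′ y′
  circ-reflect r {x} {y} {x′} {y′} (s , s∈S , inj₁ y≡x+s) x′≡ y′≡ = s , s∈S , inj₂
    (Equivalence.from (%-step⇔ y′ x′ s)
      (reflect-step r {c = + s} (Equivalence.to (%-step⇔ x y s) y≡x+s) x′≡ y′≡))
  circ-reflect r {x} {y} {x′} {y′} (s , s∈S , inj₂ x≡y+s) x′≡ y′≡ = s , s∈S , inj₁
    (Equivalence.from (%-step⇔ x′ y′ s)
      (reflect-step r {c = + s} (Equivalence.to (%-step⇔ y x s) x≡y+s) y′≡ x′≡))

module CirculantLabelling {G : Graph} {m : ℕ} .{{_ : NonZero m}} {S : ℕ → Set} (iso : G ≅ Circ m S) where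

  open Bijection (proj₁ iso) using (to; strictlySurjective)

  label : Vertex G → ℤ
  label x = ι (to x)

  label-surjective : ∀ r → ∃ λ w → label w ≡ r mod m
  label-surjective r = let w , to-w≡ = strictlySurjective (residue r) in
    w , subst (λ i → ι i ≡ r mod m) (sym to-w≡) (ι-residue r)

  adj-reflect : ∀ r {x y x′ y′} → Adj G x y →
                label x′ ≡ r - label x mod m → label y′ ≡ r - label y mod m → Adj G x′ y′
  adj-reflect r {x} {y} {x′} {y′} x~y x′≡ y′≡ =
    Equivalence.from (proj₂ iso x′ y′) (circ-reflect r (Equivalence.to (proj₂ iso x y) x~y) x′≡ y′≡)

  reflect-neighbour : ∀ {x a w} → Adj G x a → label w ≡ label x + label x - label a mod m → Adj G x w
  reflect-neighbour {x} {a} x~a w≡ = adj-reflect (label x + label x) x~a x≡ w≡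
    where x≡ : label x ≡ label x + label x - label x mod m
          x≡ = ≡⇒≡mod (cancel (label x))
            where cancel : ∀ a → a ≡ a + a - a
                  cancel = solve-∀

  unique-common-neighbour⇒midpoint : ∀ {x a b} → Adj G x a → Adj G x b →
                                      (∀ {w} → Adj G w a → Adj G w b → w ≡ x) →
                                      label a + label b ≡ label x + label x mod m
  unique-common-neighbour⇒midpoint {x} {a} {b} x~a x~b unique = midpoint (label-surjective (r - label x))
    where
    r : ℤ
    r = label a + label b
    other-end : ∀ a b → b ≡ a + b - a
    other-end = solve-∀
    a≡r-b : label a ≡ r - label b mod m
    a≡r-b = subst (λ r → label a ≡ r - label b mod m) (ℤ.+-comm (label b) (label a))
                  (≡⇒≡mod (other-end (label b) (label a)))
    b≡r-a : label b ≡ r - label a mod m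
    b≡r-a = ≡⇒≡mod (other-end (label a) (label b))
    sub-add : ∀ r a → r ≡ (r - a) + a
    sub-add = solve-∀
    midpoint : (∃ λ w → label w ≡ r - label x mod m) → r ≡ label x + label x mod m
    midpoint (w , w≡) = begin
      r                   ≡⟨ sub-add r (label x) ⟩
      (r - label x) + label x ≈⟨ +-congʳ-mod (label x) (≡mod-sym x≡r-x) ⟩
      label x + label x   ∎
      where
      open ≡mod-Reasoning m
      x≡r-x : label x ≡ r - label x mod m
      x≡r-x = subst (λ v → label v ≡ r - label x mod m)
                    (unique (adj-reflect r x~b w≡ a≡r-b) (adj-reflect r x~a w≡ b≡r-a)) w≡

module _ {m : ℕ} (g : ℕ → ℤ)
         (midpoint : ∀ j → g j + g (2 ℕ.+ j) ≡ g (1 ℕ.+ j) + g (1 ℕ.+ j) mod m) where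

  arithmetic-progression : ∀ j → g j ≡ g 0 + + j * (g 1 - g 0) mod m
  arithmetic-progression j = proj₁ (two-terms j)
    where
    t : ℤ
    t = g 1 - g 0
    Term : ℕ → Set
    Term j = g j ≡ g 0 + + j * t mod m
    zeroth : ∀ a b → a ≡ a + 0ℤ * (b - a)
    zeroth = solve-∀
    first : ∀ a b → b ≡ a + 1ℤ * (b - a)
    first = solve-∀
    extrapolate : ∀ a t j → (a + (1ℤ + j) * t) + (a + (1ℤ + j) * t) - (a + j * t) ≡ a + (+ 2 + j) * t
    extrapolate = solve-∀
    add-sub : ∀ a b → b ≡ a + b - a
    add-sub = solve-∀
    next : ∀ j → Term j → Term (1 ℕ.+ j) → Term (2 ℕ.+ j)
    next j gj g1+j = begin
      g (2 ℕ.+ j)                                      ≡⟨ add-sub (g j) (g (2 ℕ.+ j)) ⟩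
      g j + g (2 ℕ.+ j) - g j                          ≈⟨ +-cong-mod (midpoint j) (neg-cong-mod gj) ⟩
      g (1 ℕ.+ j) + g (1 ℕ.+ j) - (g 0 + + j * t)      ≈⟨ +-congʳ-mod _ (+-cong-mod g1+j g1+j) ⟩
      (g 0 + + (1 ℕ.+ j) * t) + (g 0 + + (1 ℕ.+ j) * t) - (g 0 + + j * t) ≡⟨ extrapolate (g 0) t (+ j) ⟩
      g 0 + + (2 ℕ.+ j) * t                            ∎
      where open ≡mod-Reasoning m
    two-terms : ∀ j → Term j × Term (1 ℕ.+ j)
    two-terms zero    = ≡⇒≡mod (zeroth (g 0) (g 1)) , ≡⇒≡mod (first (g 0) (g 1))
    two-terms (suc j) = let (gj , g1+j) = two-terms j in g1+j , next j gj g1+j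

2∣n+n : ∀ n → 2 ℕ.∣ n ℕ.+ n
2∣n+n n = subst (2 ℕ.∣_) (cong (n ℕ.+_) (ℕ.+-identityʳ n)) (ℕ.m∣m*n n)

4∣n+n : ∀ {n} → 2 ℕ.∣ n → 4 ℕ.∣ n ℕ.+ n
4∣n+n {n} 2∣n = subst (4 ℕ.∣_) (cong (n ℕ.+_) (ℕ.+-identityʳ n)) (ℕ.*-monoʳ-∣ 2 2∣n)

module _ {n : ℕ} .{{_ : NonZero n}} (g : ℕ → ℤ)
         (midpoint : ∀ j → g j + g (2 ℕ.+ j) ≡ g (1 ℕ.+ j) + g (1 ℕ.+ j) mod n ℕ.+ n)
         (period : g n ≡ g 0 mod n ℕ.+ n) where

  private
    t : ℤ
    t = g 1 - g 0
    progression : ∀ j → g j ≡ g 0 + + j * t mod n ℕ.+ n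
    progression = arithmetic-progression g midpoint

  even-common-difference : + 2 ∣ g 1 - g 0
  even-common-difference = *-cancelˡ-∣ (+ n) step
    where
    open ≡mod-Reasoning (n ℕ.+ n)
    double : ∀ a → a + a ≡ a * + 2
    double = solve-∀
    add-sub : ∀ a b → b ≡ a + b - a
    add-sub = solve-∀
    nt≡0 : + n * t ≡ 0ℤ mod n ℕ.+ n
    nt≡0 = begin
      + n * t               ≡⟨ add-sub (g 0) (+ n * t) ⟩
      g 0 + + n * t - g 0   ≈⟨ +-congʳ-mod (- g 0) (≡mod-sym (progression n)) ⟩
      g n - g 0             ≈⟨ +-congʳ-mod (- g 0) period ⟩
      g 0 - g 0             ≡⟨ ℤ.+-inverseʳ (g 0) ⟩
      0ℤ                    ∎
    step : + n * + 2 ∣ + n * t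
    step = subst (_∣ + n * t) (double (+ n)) (≡0-mod⇒∣ nt≡0)

  private
    progression-mod : ∀ {d} j → d ℕ.∣ n ℕ.+ n → + d ∣ + j * t → g j ≡ g 0 mod d
    progression-mod {d} j d∣2n d∣jt = begin
      g j            ≈⟨ ≡mod-weaken d∣2n (progression j) ⟩
      g 0 + + j * t  ≈⟨ +-congˡ-mod (g 0) (∣⇒≡0-mod d∣jt) ⟩
      g 0 + 0ℤ       ≡⟨ ℤ.+-identityʳ (g 0) ⟩
      g 0            ∎
      where open ≡mod-Reasoning d

  constant-parity : ∀ j → g j ≡ g 0 mod 2
  constant-parity j = progression-mod j (2∣n+n n) (∣n⇒∣m*n (+ j) even-common-difference)

  even-terms-mod-4 : 2 ℕ.∣ n → ∀ j → g (j ℕ.+ j) ≡ g 0 mod 4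
  even-terms-mod-4 2∣n j = progression-mod (j ℕ.+ j) (4∣n+n 2∣n) 4∣jt
    where
    q : ℤ
    q = quotient even-common-difference
    4∣jt : + 4 ∣ + (j ℕ.+ j) * t
    4∣jt = divides (+ j * q)
      (trans (cong (+ (j ℕ.+ j) *_) (_∣_.equality even-common-difference)) (quadruple (+ j) q))
      where quadruple : ∀ j q → (j + j) * (q * + 2) ≡ (j * q) * + 4
            quadruple = solve-∀

CycleAdj : ℕ → ℤ → ℤ → Set
CycleAdj n a b = b ≡ a + 1ℤ mod n ⊎ a ≡ b + 1ℤ mod n

RungOffset : ℕ → ℕ → ℤ → Set
RungOffset n k e = e ≡ 0ℤ mod n ⊎ e ≡ + k mod n

AccAdj : ∀ n k → Fin n ⊎ Fin n → Fin n ⊎ Fin n → Set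
AccAdj n k (inj₁ i) (inj₁ j) = CycleAdj n (ι i) (ι j)
AccAdj n k (inj₂ i) (inj₂ j) = CycleAdj n (ι i) (ι j)
AccAdj n k (inj₁ i) (inj₂ j) = RungOffset n k (ι j - ι i)
AccAdj n k (inj₂ i) (inj₁ j) = RungOffset n k (ι i - ι j)

module _ {m : ℕ} where

  CycleAdj-sym : ∀ {a b} → CycleAdj m a b → CycleAdj m b a
  CycleAdj-sym (inj₁ b≡a+1) = inj₂ b≡a+1
  CycleAdj-sym (inj₂ a≡b+1) = inj₁ a≡b+1

  CycleAdj-resp : ∀ {a a′ b b′} → a ≡ a′ mod m → b ≡ b′ mod m → CycleAdj m a b → CycleAdj m a′ b′
  CycleAdj-resp a≡a′ b≡b′ (inj₁ b≡a+1) =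
    inj₁ (≡mod-trans (≡mod-sym b≡b′) (≡mod-trans b≡a+1 (+-congʳ-mod 1ℤ a≡a′)))
  CycleAdj-resp a≡a′ b≡b′ (inj₂ a≡b+1) =
    inj₂ (≡mod-trans (≡mod-sym a≡a′) (≡mod-trans a≡b+1 (+-congʳ-mod 1ℤ b≡b′)))

  CycleAdj-translate : ∀ c {a b} → CycleAdj m a b → CycleAdj m (a + c) (b + c)
  CycleAdj-translate c {a} {b} (inj₁ b≡a+1) = inj₁ (≡mod-by-difference (shift b a c) b≡a+1)
    where shift : ∀ b a c → b - (a + 1ℤ) ≡ (b + c) - ((a + c) + 1ℤ)
          shift = solve-∀
  CycleAdj-translate c {a} {b} (inj₂ a≡b+1) = inj₂ (≡mod-by-difference (shift a b c) a≡b+1)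
    where shift : ∀ a b c → a - (b + 1ℤ) ≡ (a + c) - ((b + c) + 1ℤ)
          shift = solve-∀

  RungOffset-resp : ∀ {k e e′} → e ≡ e′ mod m → RungOffset m k e → RungOffset m k e′
  RungOffset-resp e≡e′ (inj₁ e≡0) = inj₁ (≡mod-trans (≡mod-sym e≡e′) e≡0)
  RungOffset-resp e≡e′ (inj₂ e≡k) = inj₂ (≡mod-trans (≡mod-sym e≡e′) e≡k)

module _ {n k : ℕ} .{{_ : NonZero n}} where

  private
    edge⇒AccAdj : ∀ {x y} → AccEdge n k x y → AccAdj n k x y
    edge⇒AccAdj (uu i j e)  = inj₁ (Equivalence.to (%-step⇔ i j 1) e)
    edge⇒AccAdj (vv i j e)  = inj₁ (Equivalence.to (%-step⇔ i j 1) e)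
    edge⇒AccAdj (uv i)      = inj₁ (≡⇒≡mod (ℤ.+-inverseʳ (ι i)))
    edge⇒AccAdj (uvk i j e) =
      inj₂ (Equivalence.to (≡+⇔-≡ {a = ι i} {c = + k}) (Equivalence.to (%-step⇔ i j k) e))

    AccAdj-sym : ∀ {x y} → AccAdj n k x y → AccAdj n k y x
    AccAdj-sym {inj₁ _} {inj₁ _} = CycleAdj-sym
    AccAdj-sym {inj₂ _} {inj₂ _} = CycleAdj-sym
    AccAdj-sym {inj₁ _} {inj₂ _} r = r
    AccAdj-sym {inj₂ _} {inj₁ _} r = r

    same-index : ∀ {i j : Fin n} → ι j - ι i ≡ 0ℤ mod n → j ≡ i
    same-index {i} {j} j-i≡0 =
      ι-injective (subst (λ a → ι j ≡ a mod n) (ℤ.+-identityʳ (ι i))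
                         (Equivalence.from (≡+⇔-≡ {a = ι i} {c = 0ℤ}) j-i≡0))

    from-offset : ∀ {i j : Fin n} → ι j - ι i ≡ + k mod n → toℕ j ≡ (toℕ i ℕ.+ k) ℕ.% n
    from-offset {i} {j} = Equivalence.from (%-step⇔ i j k) ∘ Equivalence.from (≡+⇔-≡ {a = ι i} {c = + k})

    AccAdj⇒Adj : ∀ x y → AccAdj n k x y → Adj (Accordion n k) x y
    AccAdj⇒Adj (inj₁ i) (inj₁ j) (inj₁ j≡i+1) = inj₁ (uu i j (Equivalence.from (%-step⇔ i j 1) j≡i+1))
    AccAdj⇒Adj (inj₁ i) (inj₁ j) (inj₂ i≡j+1) = inj₂ (uu j i (Equivalence.from (%-step⇔ j i 1) i≡j+1))
    AccAdj⇒Adj (inj₂ i) (inj₂ j) (inj₁ j≡i+1) = inj₁ (vv i j (Equivalence.from (%-step⇔ i j 1) j≡i+1))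
    AccAdj⇒Adj (inj₂ i) (inj₂ j) (inj₂ i≡j+1) = inj₂ (vv j i (Equivalence.from (%-step⇔ j i 1) i≡j+1))
    AccAdj⇒Adj (inj₁ i) (inj₂ j) (inj₁ j-i≡0) =
      subst (λ j → Adj (Accordion n k) (inj₁ i) (inj₂ j)) (sym (same-index j-i≡0)) (inj₁ (uv i))
    AccAdj⇒Adj (inj₁ i) (inj₂ j) (inj₂ j-i≡k) = inj₁ (uvk i j (from-offset j-i≡k))
    AccAdj⇒Adj (inj₂ i) (inj₁ j) (inj₁ i-j≡0) =
      subst (λ i → Adj (Accordion n k) (inj₂ i) (inj₁ j)) (sym (same-index i-j≡0)) (inj₂ (uv j))
    AccAdj⇒Adj (inj₂ i) (inj₁ j) (inj₂ i-j≡k) = inj₂ (uvk j i (from-offset i-j≡k))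

  accordion-adj⇔ : ∀ {x y} → Adj (Accordion n k) x y ⇔ AccAdj n k x y
  accordion-adj⇔ {x} {y} = mk⇔ adj⇒AccAdj (AccAdj⇒Adj x y)
    where adj⇒AccAdj : Adj (Accordion n k) x y → AccAdj n k x y
          adj⇒AccAdj (inj₁ x→y) = edge⇒AccAdj x→y
          adj⇒AccAdj (inj₂ y→x) = AccAdj-sym (edge⇒AccAdj y→x)

cycle-common-neighbour : ∀ {n a z} → 4 ℕ.< n →
                         CycleAdj n a z → CycleAdj n a (+ 2 + z) → a ≡ 1ℤ + z mod n
cycle-common-neighbour {z = z} _ (inj₂ a≡z+1) _ = ≡mod-trans a≡z+1 (≡⇒≡mod (ℤ.+-comm z 1ℤ))
cycle-common-neighbour {z = z} 4<n (inj₁ z≡a+1) (inj₁ 2+z≡a+1) =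
  ⊥-elim (nonzero-shift-≢mod z (s≤s z≤n) (ℕ.<-trans (s≤s (s≤s (s≤s z≤n))) 4<n)
                             (≡mod-trans 2+z≡a+1 (≡mod-sym z≡a+1)))
cycle-common-neighbour {n} {a} {z} 4<n (inj₁ z≡a+1) (inj₂ a≡2+z+1) =
  ⊥-elim (nonzero-shift-≢mod z (s≤s z≤n) 4<n (begin
  + 4 + z               ≡⟨ solve (z ∷ []) ⟩
  (+ 2 + z + 1ℤ) + 1ℤ   ≈⟨ +-congʳ-mod 1ℤ (≡mod-sym a≡2+z+1) ⟩
  a + 1ℤ                ≈⟨ ≡mod-sym z≡a+1 ⟩
  z                     ∎))
  where open ≡mod-Reasoning n

module _ {n k : ℕ} (2<k : 2 ℕ.< k) (2+k<n : 2 ℕ.+ k ℕ.< n) where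

  private
    k<n : k ℕ.< n
    k<n = ℕ.≤-<-trans (ℕ.m≤n+m k 2) 2+k<n
    2<n : 2 ℕ.< n
    2<n = ℕ.<-trans 2<k k<n
    0<n : 0 ℕ.< n
    0<n = ℕ.<-trans (s≤s z≤n) 2<n
    shifted : ∀ {e x y} → e ≡ + x mod n → + 2 + e ≡ + y mod n → + (2 ℕ.+ x) ≡ + y mod n
    shifted e≡x 2+e≡y = ≡mod-trans (+-congˡ-mod (+ 2) (≡mod-sym e≡x)) 2+e≡y

  rung-offsets-not-two-apart : ∀ {e} → RungOffset n k e → ¬ RungOffset n k (+ 2 + e)
  rung-offsets-not-two-apart (inj₁ e≡0) (inj₁ 2+e≡0) =
    contradiction (≡mod⇒≡ 2<n 0<n (shifted e≡0 2+e≡0)) λ ()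
  rung-offsets-not-two-apart (inj₁ e≡0) (inj₂ 2+e≡k) =
    ℕ.<-irrefl (≡mod⇒≡ 2<n k<n (shifted e≡0 2+e≡k)) 2<k
  rung-offsets-not-two-apart (inj₂ e≡k) (inj₁ 2+e≡0) =
    contradiction (≡mod⇒≡ 2+k<n 0<n (shifted e≡k 2+e≡0)) λ ()
  rung-offsets-not-two-apart (inj₂ e≡k) (inj₂ 2+e≡k) =
    ℕ.m≢1+n+m k (sym (≡mod⇒≡ 2+k<n k<n (shifted e≡k 2+e≡k)))

module AccordionVertices (n k : ℕ) .{{_ : NonZero n}} where

  u v : ℤ → Vertex (Accordion n k)
  u z = inj₁ (residue z)
  v z = inj₂ (residue z)

  u-ι : ∀ i → u (ι i) ≡ inj₁ i
  u-ι i = cong inj₁ (residue-ι i)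

  v-ι : ∀ i → v (ι i) ≡ inj₂ i
  v-ι i = cong inj₂ (residue-ι i)

  private
    successor : ∀ z → ι (residue {n} (1ℤ + z)) ≡ ι (residue {n} z) + 1ℤ mod n
    successor z = ≡mod-trans (ι-residue (1ℤ + z))
      (≡mod-trans (≡⇒≡mod (ℤ.+-comm 1ℤ z)) (+-congʳ-mod 1ℤ (≡mod-sym (ι-residue z))))

  u~u : ∀ z → Adj (Accordion n k) (u z) (u (1ℤ + z))
  u~u z = Equivalence.from accordion-adj⇔ (inj₁ (successor z))

  v~v : ∀ z → Adj (Accordion n k) (v z) (v (1ℤ + z))
  v~v z = Equivalence.from accordion-adj⇔ (inj₁ (successor z))

  u~v : ∀ z → Adj (Accordion n k) (u z) (v z)
  u~v z = inj₁ (uv (residue z))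

  private
    cycle-at-u : ∀ {i} z → Adj (Accordion n k) (inj₁ i) (u z) → CycleAdj n (ι i) z
    cycle-at-u z a = CycleAdj-resp ≡mod-refl (ι-residue z) (Equivalence.to accordion-adj⇔ a)

    cycle-at-v : ∀ {i} z → Adj (Accordion n k) (inj₂ i) (v z) → CycleAdj n (ι i) z
    cycle-at-v z a = CycleAdj-resp ≡mod-refl (ι-residue z) (Equivalence.to accordion-adj⇔ a)

    rung-at-u : ∀ {i} z → Adj (Accordion n k) (inj₂ i) (u z) → RungOffset n k (ι i - z)
    rung-at-u {i} z a =
      RungOffset-resp (+-congˡ-mod (ι i) (neg-cong-mod (ι-residue z))) (Equivalence.to accordion-adj⇔ a)

    rung-at-v : ∀ {i} z → Adj (Accordion n k) (inj₁ i) (v z) → RungOffset n k (z - ι i)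
    rung-at-v {i} z a = RungOffset-resp (+-congʳ-mod (- ι i) (ι-residue z)) (Equivalence.to accordion-adj⇔ a)

    two-apart : ∀ a z → a - z ≡ + 2 + (a - (+ 2 + z)) × (+ 2 + z) - a ≡ + 2 + (z - a)
    two-apart a z = solve (a ∷ z ∷ []) , solve (a ∷ z ∷ [])

  u-neighbour-v : ∀ z {i} → Adj (Accordion n k) (u z) (inj₂ i) → inj₂ i ≡ v z ⊎ inj₂ i ≡ v (z + + k)
  u-neighbour-v z {i} u~vᵢ = offset (rung-at-u z (swap u~vᵢ))
    where
    offset : RungOffset n k (ι i - z) → inj₂ i ≡ v z ⊎ inj₂ i ≡ v (z + + k)
    offset (inj₁ i-z≡0) =
      inj₁ (cong inj₂ (≡residue (subst (λ b → ι i ≡ b mod n) (ℤ.+-identityʳ z)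
                                       (Equivalence.from (≡+⇔-≡ {a = z}) i-z≡0))))
    offset (inj₂ i-z≡k) = inj₂ (cong inj₂ (≡residue (Equivalence.from (≡+⇔-≡ {a = z}) i-z≡k)))

  module _ (2<k : 2 ℕ.< k) (2+k<n : 2 ℕ.+ k ℕ.< n) where

    private
      4<n : 4 ℕ.< n
      4<n = ℕ.<-trans (ℕ.+-monoʳ-< 2 2<k) 2+k<n

    u-common-neighbour : ∀ z {w} → Adj (Accordion n k) w (u z) → Adj (Accordion n k) w (u (+ 2 + z)) →
                         w ≡ u (1ℤ + z)
    u-common-neighbour z {inj₁ i} w~z w~2+z =
      cong inj₁ (≡residue (cycle-common-neighbour 4<n (cycle-at-u z w~z) (cycle-at-u (+ 2 + z) w~2+z)))
    u-common-neighbour z {inj₂ i} w~z w~2+z = ⊥-elim (rung-offsets-not-two-apart 2<k 2+k<n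
      (rung-at-u (+ 2 + z) w~2+z) (RungOffset-resp (≡⇒≡mod (proj₁ (two-apart (ι i) z))) (rung-at-u z w~z)))

    v-common-neighbour : ∀ z {w} → Adj (Accordion n k) w (v z) → Adj (Accordion n k) w (v (+ 2 + z)) →
                         w ≡ v (1ℤ + z)
    v-common-neighbour z {inj₂ i} w~z w~2+z =
      cong inj₂ (≡residue (cycle-common-neighbour 4<n (cycle-at-v z w~z) (cycle-at-v (+ 2 + z) w~2+z)))
    v-common-neighbour z {inj₁ i} w~z w~2+z = ⊥-elim (rung-offsets-not-two-apart 2<k 2+k<n
      (rung-at-v z w~z) (RungOffset-resp (≡⇒≡mod (proj₂ (two-apart (ι i) z))) (rung-at-v (+ 2 + z) w~2+z)))

module _ {n k : ℕ} .{{_ : NonZero n}} .{{_ : NonZero (n ℕ.+ n)}} {S : ℕ → Set}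
         (2∣n : 2 ℕ.∣ n) (2∣k : 2 ℕ.∣ k) (2<k : 2 ℕ.< k) (2+k<n : 2 ℕ.+ k ℕ.< n)
         (iso : Accordion n k ≅ Circ (n ℕ.+ n) S) where

  open CirculantLabelling iso
  open AccordionVertices n k

  private
    c d : ℤ
    c = label (u 0ℤ)
    d = label (v 0ℤ)

    gᵤ gᵥ : ℕ → ℤ
    gᵤ j = label (u (+ j))
    gᵥ j = label (v (+ j))

    u-midpoint : ∀ j → gᵤ j + gᵤ (2 ℕ.+ j) ≡ gᵤ (1 ℕ.+ j) + gᵤ (1 ℕ.+ j) mod n ℕ.+ n
    u-midpoint j = unique-common-neighbour⇒midpoint (swap (u~u (+ j))) (u~u (1ℤ + + j))
                                                    (u-common-neighbour 2<k 2+k<n (+ j))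

    v-midpoint : ∀ j → gᵥ j + gᵥ (2 ℕ.+ j) ≡ gᵥ (1 ℕ.+ j) + gᵥ (1 ℕ.+ j) mod n ℕ.+ n
    v-midpoint j = unique-common-neighbour⇒midpoint (swap (v~v (+ j))) (v~v (1ℤ + + j))
                                                    (v-common-neighbour 2<k 2+k<n (+ j))

    u-period : gᵤ n ≡ gᵤ 0 mod n ℕ.+ n
    u-period = ≡⇒≡mod (cong (label ∘ inj₁) (residue-cong modulus≡0))

    v-period : gᵥ n ≡ gᵥ 0 mod n ℕ.+ n
    v-period = ≡⇒≡mod (cong (label ∘ inj₂) (residue-cong modulus≡0))

    u-parity : ∀ i → label (inj₁ i) ≡ c mod 2
    u-parity i = subst (λ x → label x ≡ c mod 2) (u-ι i) (constant-parity gᵤ u-midpoint u-period (toℕ i))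

    v-parity : ∀ i → label (inj₂ i) ≡ d mod 2
    v-parity i = subst (λ x → label x ≡ d mod 2) (v-ι i) (constant-parity gᵥ v-midpoint v-period (toℕ i))

    v-k-mod-4 : label (v (+ k)) ≡ d mod 4
    v-k-mod-4 = subst (λ j → gᵥ j ≡ d mod 4) q+q≡k (even-terms-mod-4 gᵥ v-midpoint v-period 2∣n q)
      where
      q : ℕ
      q = ℕ.quotient 2∣k
      q+q≡k : q ℕ.+ q ≡ k
      q+q≡k = sym (trans (ℕ.m∣n⇒n≡m*quotient 2∣k) (cong (q ℕ.+_) (ℕ.+-identityʳ q)))

    v-neighbour-of-u₀-mod-4 : ∀ i → Adj (Accordion n k) (u 0ℤ) (inj₂ i) → label (inj₂ i) ≡ d mod 4
    v-neighbour-of-u₀-mod-4 i u₀~vᵢ with u-neighbour-v 0ℤ u₀~vᵢ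
    ... | inj₁ vᵢ≡v₀ = ≡⇒≡mod (cong label vᵢ≡v₀)
    ... | inj₂ vᵢ≡vₖ = ≡mod-trans (≡⇒≡mod (cong label vᵢ≡vₖ)) v-k-mod-4

    -- The reflection w of v₀ through u₀ is a neighbour of u₀: either some u_i, of the parity of c,
    -- or one of v₀ and v_k, whose labels agree with d mod 4 since k is even.
    c≡d : c ≡ d mod 2
    c≡d = reflect-v₀ (label-surjective (c + c - d))
      where
      reflect-v₀ : (∃ λ w → label w ≡ c + c - d mod n ℕ.+ n) → c ≡ d mod 2
      reflect-v₀ (inj₁ i , w≡) = ≡mod-sym (reflection≡centre⇒≡ (≡mod-weaken (2∣n+n n) w≡) (u-parity i))
      reflect-v₀ (inj₂ i , w≡) = reflection≡point⇒≡ (≡mod-weaken (4∣n+n 2∣n) w≡)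
                                   (v-neighbour-of-u₀-mod-4 i (reflect-neighbour (u~v 0ℤ) w≡))

    label-parity : ∀ x → label x ≡ c mod 2
    label-parity (inj₁ i) = u-parity i
    label-parity (inj₂ i) = ≡mod-trans (v-parity i) (≡mod-sym c≡d)

  accordion≇Circ : ⊥
  accordion≇Circ = let w , w≡ = label-surjective (1ℤ + c) in
    nonzero-shift-≢mod c (s≤s z≤n) (s≤s (s≤s z≤n))
                       (≡mod-trans (≡mod-sym (≡mod-weaken (2∣n+n n) w≡)) (label-parity w))

accordion-not-circulant : ∀ {n k} .{{_ : NonZero n}} → 2 ℕ.∣ n → 2 ℕ.∣ k → 4 ℕ.≤ k → 2 ℕ.* k ℕ.≤ n →
                          ¬ IsCirculant (Accordion n k)
accordion-not-circulant {n} {k} 2∣n 2∣k 4≤k 2k≤n (m , nz , S , _ , iso@(f , _))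
  with refl ← ↔⇒≡ (↔-trans +↔⊎ (⤖⇒↔ f)) =
  accordion≇Circ {{_}} {{nz}} 2∣n 2∣k 2<k 2+k<n iso
  where
  2<k : 2 ℕ.< k
  2<k = ℕ.<-≤-trans (s≤s (s≤s (s≤s z≤n))) 4≤k
  2+k<n : 2 ℕ.+ k ℕ.< n
  2+k<n = ℕ.<-≤-trans (ℕ.+-monoˡ-< k 2<k) (subst (ℕ._≤ n) (cong (k ℕ.+_) (ℕ.+-identityʳ k)) 2k≤n)

rung₂⇔cycle : ∀ {m a b} → RungOffset m 2 (b - a) ⇔ CycleAdj m a (b - 1ℤ)
rung₂⇔cycle {m} {a} {b} = mk⇔
  (λ { (inj₁ b-a≡0) → inj₂ (≡mod-sym (≡mod-by-difference (same a b) b-a≡0))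
     ; (inj₂ b-a≡2) → inj₁ (≡mod-by-difference (two a b) b-a≡2) })
  (λ { (inj₁ b-1≡a+1) → inj₂ (≡mod-by-difference (sym (two a b)) b-1≡a+1)
     ; (inj₂ a≡b-1+1) → inj₁ (≡mod-by-difference (sym (same a b)) (≡mod-sym a≡b-1+1)) })
  where
  same : ∀ a b → b - a - 0ℤ ≡ b - 1ℤ + 1ℤ - a
  same = solve-∀
  two : ∀ a b → b - a - + 2 ≡ b - 1ℤ - (a + 1ℤ)
  two = solve-∀

module _ {n : ℕ} .{{_ : NonZero n}} where

  private
    pred-n+1 : + ℕ.pred n + 1ℤ ≡ + n
    pred-n+1 = cong +_ (trans (ℕ.+-comm (ℕ.pred n) 1) (ℕ.suc-pred n))

  ≡mod-lift : ∀ {a b} → a ≡ b mod n → a ≡ b mod n ℕ.+ n ⊎ a ≡ b + + n mod n ℕ.+ n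
  ≡mod-lift {a} {b} (mk≡mod (divides q a-b≡qn)) = by-parity (q %ℕ 2) (n%ℕd<d q 2) (a≡a%ℕn+[a/ℕn]*n q 2)
    where
    h : ℤ
    h = q /ℕ 2
    even : ∀ h N → (+ 0 + h * + 2) * N ≡ h * (N + N)
    even = solve-∀
    odd : ∀ a b h N → a - (b + N) ≡ (a - b) - N × (+ 1 + h * + 2) * N - N ≡ h * (N + N)
    odd a b h N = solve (a ∷ b ∷ N ∷ []) , solve (h ∷ N ∷ [])
    by-parity : ∀ r → r ℕ.< 2 → q ≡ + r + h * + 2 → a ≡ b mod n ℕ.+ n ⊎ a ≡ b + + n mod n ℕ.+ n
    by-parity 0 _ q≡2h = inj₁ (mk≡mod (divides h (begin
      a - b                  ≡⟨ a-b≡qn ⟩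
      q * + n                ≡⟨ cong (_* + n) q≡2h ⟩
      (+ 0 + h * + 2) * + n  ≡⟨ even h (+ n) ⟩
      h * + (n ℕ.+ n)        ∎)))
      where open ≡-Reasoning
    by-parity 1 _ q≡2h+1 = inj₂ (mk≡mod (divides h (begin
      a - (b + + n)          ≡⟨ proj₁ (odd a b h (+ n)) ⟩
      (a - b) - + n          ≡⟨ cong (_- + n) (trans a-b≡qn (cong (_* + n) q≡2h+1)) ⟩
      (+ 1 + h * + 2) * + n - + n ≡⟨ proj₂ (odd a b h (+ n)) ⟩
      h * + (n ℕ.+ n)        ∎)))
      where open ≡-Reasoning
    by-parity (suc (suc _)) (s≤s (s≤s ())) _

  unit-or-pred : ℕ → Set
  unit-or-pred s = s ≡ 1 ⊎ s ≡ ℕ.pred n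

  module _ .{{_ : NonZero (n ℕ.+ n)}} where

    private
      chord⇒cycle-step : ∀ {a b} → b ≡ a + + ℕ.pred n mod n ℕ.+ n → a ≡ b + 1ℤ mod n
      chord⇒cycle-step {a} {b} b≡a+n-1 = ≡mod-sym (begin
        b + 1ℤ                   ≈⟨ +-congʳ-mod 1ℤ (≡mod-weaken (ℕ.∣m∣n⇒∣m+n ℕ.∣-refl ℕ.∣-refl) b≡a+n-1) ⟩
        a + + ℕ.pred n + 1ℤ      ≡⟨ trans (ℤ.+-assoc a _ 1ℤ) (cong (_+_ a) pred-n+1) ⟩
        a + + n                  ≈⟨ +-congˡ-mod a modulus≡0 ⟩
        a + 0ℤ                   ≡⟨ ℤ.+-identityʳ a ⟩
        a                        ∎)
        where open ≡mod-Reasoning n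

      half-turn-step⇒chord : ∀ {a b} → b ≡ a + 1ℤ + + n mod n ℕ.+ n → a ≡ b + + ℕ.pred n mod n ℕ.+ n
      half-turn-step⇒chord {a} {b} b≡a+1+n = ≡mod-sym (begin
        b + + ℕ.pred n                   ≈⟨ +-congʳ-mod (+ ℕ.pred n) b≡a+1+n ⟩
        a + 1ℤ + + n + + ℕ.pred n        ≡⟨ regroup a (+ n) (+ ℕ.pred n) ⟩
        a + (+ ℕ.pred n + 1ℤ + + n)      ≡⟨ cong (λ x → a + (x + + n)) pred-n+1 ⟩
        a + (+ n + + n)                  ≈⟨ +-congˡ-mod a modulus≡0 ⟩
        a + 0ℤ                           ≡⟨ ℤ.+-identityʳ a ⟩
        a                                ∎)
        where open ≡mod-Reasoning (n ℕ.+ n)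
              regroup : ∀ a N p → a + 1ℤ + N + p ≡ a + (p + 1ℤ + N)
              regroup = solve-∀

    circ₂-adj⇔ : ∀ {x y : Fin (n ℕ.+ n)} →
                 Adj (Circ (n ℕ.+ n) unit-or-pred) x y ⇔ CycleAdj n (ι x) (ι y)
    circ₂-adj⇔ {x} {y} = mk⇔ to from
      where
      n∣2n : n ℕ.∣ n ℕ.+ n
      n∣2n = ℕ.∣m∣n⇒∣m+n ℕ.∣-refl ℕ.∣-refl
      step : ∀ i j s → (toℕ j ≡ (toℕ i ℕ.+ s) ℕ.% (n ℕ.+ n)) ⇔ (ι j ≡ ι i + + s mod n ℕ.+ n)
      step = %-step⇔
      to : Adj (Circ (n ℕ.+ n) unit-or-pred) x y → CycleAdj n (ι x) (ι y)
      to (_ , inj₁ refl , inj₁ e) = inj₁ (≡mod-weaken n∣2n (Equivalence.to (step x y 1) e))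
      to (_ , inj₁ refl , inj₂ e) = inj₂ (≡mod-weaken n∣2n (Equivalence.to (step y x 1) e))
      to (_ , inj₂ refl , inj₁ e) = inj₂ (chord⇒cycle-step (Equivalence.to (step x y _) e))
      to (_ , inj₂ refl , inj₂ e) = inj₁ (chord⇒cycle-step (Equivalence.to (step y x _) e))
      from : CycleAdj n (ι x) (ι y) → Adj (Circ (n ℕ.+ n) unit-or-pred) x y
      from (inj₁ y≡x+1) with ≡mod-lift y≡x+1
      ... | inj₁ y≡x+1′ = 1 , inj₁ refl , inj₁ (Equivalence.from (step x y 1) y≡x+1′)
      ... | inj₂ y≡x+1+n =
        ℕ.pred n , inj₂ refl , inj₂ (Equivalence.from (step y x _) (half-turn-step⇒chord y≡x+1+n))
      from (inj₂ x≡y+1) with ≡mod-lift x≡y+1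
      ... | inj₁ x≡y+1′ = 1 , inj₁ refl , inj₂ (Equivalence.from (step y x 1) x≡y+1′)
      ... | inj₂ x≡y+1+n =
        ℕ.pred n , inj₂ refl , inj₁ (Equivalence.from (step x y _) (half-turn-step⇒chord x≡y+1+n))

position : ∀ {n} → Fin n ⊎ Fin n → ℤ
position (inj₁ i) = ι i
position (inj₂ i) = ι i - 1ℤ

module _ {n : ℕ} .{{_ : NonZero n}} where

  accordion₂-adj⇔ : ∀ {x y} → AccAdj n 2 x y ⇔ CycleAdj n (position x) (position y)
  accordion₂-adj⇔ {inj₁ i} {inj₁ j} = ⇔.refl
  accordion₂-adj⇔ {inj₂ i} {inj₂ j} =
    mk⇔ (CycleAdj-translate -1ℤ)
        (CycleAdj-resp (back (ι i)) (back (ι j)) ∘ CycleAdj-translate 1ℤ {ι i - 1ℤ} {ι j - 1ℤ})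
    where back : ∀ a → a - 1ℤ + 1ℤ ≡ a mod n
          back a = ≡⇒≡mod (solve (a ∷ []))
  accordion₂-adj⇔ {inj₁ i} {inj₂ j} = rung₂⇔cycle {a = ι i} {b = ι j}
  accordion₂-adj⇔ {inj₂ i} {inj₁ j} =
    ⇔.trans (rung₂⇔cycle {a = ι j} {b = ι i}) (mk⇔ CycleAdj-sym CycleAdj-sym)

  private
    translation-inverse : ∀ c (i : Fin n) → residue (ι (residue {n} (ι i + c)) - c) ≡ i
    translation-inverse c i = sym (≡residue (begin
      ι i                         ≡⟨ add-sub (ι i) c ⟩
      ι i + c - c                 ≈⟨ +-congʳ-mod (- c) (≡mod-sym (ι-residue (ι i + c))) ⟩
      ι (residue (ι i + c)) - c   ∎))
      where open ≡mod-Reasoning n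
            add-sub : ∀ a c → a ≡ a + c - c
            add-sub = solve-∀

  rotation : Fin n ↔ Fin n
  rotation = mk↔ₛ′ (λ i → residue (ι i + -1ℤ)) (λ i → residue (ι i + 1ℤ))
                   (translation-inverse 1ℤ) (translation-inverse -1ℤ)

  -- u_i ↦ i and v_i ↦ n + (i − 1 mod n): positions along the Hamiltonian cycle.
  accordion₂-labelling : (Fin n ⊎ Fin n) ⤖ Fin (n ℕ.+ n)
  accordion₂-labelling = ↔⇒⤖ (↔-trans (↔-refl ⊎-↔ rotation) (↔-sym +↔⊎))

  label≡position : ∀ x → ι (Bijection.to accordion₂-labelling x) ≡ position x mod n
  label≡position (inj₁ i) = ≡⇒≡mod (cong +_ (toℕ-↑ˡ i n))
  label≡position (inj₂ i) = begin
    + toℕ (n ↑ʳ r)  ≡⟨ cong +_ (toℕ-↑ʳ n r) ⟩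
    + n + ι r       ≈⟨ +-congʳ-mod (ι r) modulus≡0 ⟩
    0ℤ + ι r        ≡⟨ ℤ.+-identityˡ (ι r) ⟩
    ι r             ≈⟨ ι-residue (ι i + -1ℤ) ⟩
    ι i - 1ℤ        ∎
    where open ≡mod-Reasoning n
          r : Fin n
          r = residue (ι i + -1ℤ)

accordion₂-circulant : ∀ n .{{_ : NonZero n}} → 2 ℕ.≤ n → IsCirculant (Accordion n 2)
accordion₂-circulant n 2≤n = n ℕ.+ n , 2n≢0 , unit-or-pred , bounds , accordion₂-labelling , adjacency
  where
  instance
    2n≢0 : NonZero (n ℕ.+ n)
    2n≢0 = ℕ.>-nonZero (ℕ.<-≤-trans (ℕ.>-nonZero⁻¹ n) (ℕ.m≤m+n n n))
  bounds : ∀ s → unit-or-pred s → 0 ℕ.< s × s ℕ.< n ℕ.+ n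
  bounds _ (inj₁ refl) = s≤s z≤n , ℕ.<-≤-trans 2≤n (ℕ.m≤m+n n n)
  bounds _ (inj₂ refl) =
    ℕ.suc[m]≤n⇒m≤pred[n] 2≤n , ℕ.<-≤-trans (ℕ.m≤pred[n]⇒suc[m]≤n ℕ.≤-refl) (ℕ.m≤m+n n n)
  ψ : Fin n ⊎ Fin n → Fin (n ℕ.+ n)
  ψ = Bijection.to accordion₂-labelling
  adjacency : ∀ x y → Adj (Accordion n 2) x y ⇔ Adj (Circ (n ℕ.+ n) unit-or-pred) (ψ x) (ψ y)
  adjacency x y = ⇔.trans accordion-adj⇔ (⇔.trans accordion₂-adj⇔ (⇔.trans relabel (⇔.sym circ₂-adj⇔)))
    where relabel : CycleAdj n (position x) (position y) ⇔ CycleAdj n (ι (ψ x)) (ι (ψ y))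
          relabel = mk⇔ (CycleAdj-resp (≡mod-sym (label≡position x)) (≡mod-sym (label≡position y)))
                        (CycleAdj-resp (label≡position x) (label≡position y))

even-≢2⇒4≤ : ∀ {k} → 2 ℕ.∣ k → 0 ℕ.< k → k ≢ 2 → 4 ℕ.≤ k
even-≢2⇒4≤ (ℕ.divides 0 refl) () _
even-≢2⇒4≤ (ℕ.divides 1 refl) _ k≢2 = contradiction refl k≢2
even-≢2⇒4≤ (ℕ.divides (suc (suc q)) refl) _ _ = s≤s (s≤s (s≤s (s≤s z≤n)))

lemma5p4 : (n k : ℕ) .{{_ : NonZero n}} → 4 ℕ.≤ n → 2 ℕ.∣ n → 2 ℕ.∣ k → 0 ℕ.< k → 2 ℕ.* k ℕ.≤ n →
           (IsCirculant (Accordion n k) ⇔ k ≡ 2)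
lemma5p4 n k 4≤n 2∣n 2∣k 0<k 2k≤n = mk⇔
  (λ circulant → decidable-stable (k ℕ.≟ 2) λ k≢2 →
     accordion-not-circulant 2∣n 2∣k (even-≢2⇒4≤ 2∣k 0<k k≢2) 2k≤n circulant)
  (λ { refl → accordion₂-circulant n (ℕ.≤-trans (s≤s (s≤s z≤n)) 4≤n) })
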